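{- Let $S=\{x^2+c_1,x^2+c_2,\dots,x^2+c_s\}$ for some pairwise distinct integers $c_1,\dots,c_s\in\mathbb{Z}$. If $\#S\ge 3$, then there is no point $P\in\mathbb{Q}$ with finite orbit for $S$.
   Context: For a finite set $S$ of polynomials over $\mathbb{Q}$, let $M_S$ be the monoid of all finite compositions $\phi_n\circ\cdots\circ\phi_1$ ($n\ge1$, $\phi_i\in S$). The orbit of $P$ for $S$ is $\mathrm{Orb}_S(P)=\{\rho(P):\rho\in M_S\}$, and $P$ has finite orbit for $S$ if this set is finite. -}

module Defs where

open import Data.Integer using (ℤ)
open import Data.Rational using (ℚ; _+_; _*_; _/_)
open import Data.List using (List)
open import Data.List.Membership.Propositional using (_∈_)
open import Data.Product using (∃)

sq+ : ℤ → ℚ → ℚ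
sq+ c x = x * x + (c / 1)

-- The set S = {x^2 + c : c ∈ cs} is represented by the list cs of constants.
-- Orbit cs P q  means  q = ρ(P)  for some composition
-- ρ = φ_n ∘ ⋯ ∘ φ_1  (n ≥ 1, each φ_i ∈ S).
data Orbit (cs : List ℤ) (P : ℚ) : ℚ → Set where
  first : ∀ {c} → c ∈ cs → Orbit cs P (sq+ c P)
  next  : ∀ {c q} → c ∈ cs → Orbit cs P q → Orbit cs P (sq+ c q)

FiniteOrbit : List ℤ → ℚ → Set
FiniteOrbit cs P = ∃ λ (L : List ℚ) → ∀ q → Orbit cs P q → q ∈ L

-- Suppose the orbit of P is covered by a finite list.  The proof runs in two stages,
-- each of which picks an orbit element maximising some size function (such a maximum
-- exists classically; since the goal is a negation, double negation suffices).
--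
--  1. Denominators.  Writing q = n/d in lowest terms, the numerator n² + c·d² of
--     q² + c is coprime to d, so d² divides the denominator of q² + c.  An orbit
--     element a of maximal denominator therefore satisfies den(a)² ≤ den(a), hence
--     den(a) = 1, and every orbit element is an integer.
--  2. Absolute values.  On integers the maps are  z ↦ z² + c.  Take a of maximal
--     absolute value A and two constants lo, hi with hi ≥ lo + 2.  Then a² + hi ≤ A,
--     while u² + lo ≥ -A for every orbit element u; together u² > (A - 1)², so every
--     orbit element has absolute value exactly A.  But a² + c₁, a² + c₂, a² + c₃ are
--     three distinct integers of absolute value A, which is impossible.
module Submission where

open import Data.Empty using (⊥; ⊥-elim)
open import Data.Integer as ℤ using (ℤ; +_; -[1+_]; ∣_∣)
import Data.Integer.Divisibility.Signed as ℤ∣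
import Data.Integer.Properties as ℤP
import Data.Integer.Tactic.RingSolver as ℤSolver
open import Data.List using (List; []; _∷_; length)
open import Data.List.Membership.Propositional using (_∈_)
open import Data.List.Relation.Unary.All using (_∷_)
open import Data.List.Relation.Unary.AllPairs using (_∷_)
open import Data.List.Relation.Unary.Any using (here; there)
open import Data.List.Relation.Unary.Unique.Propositional using (Unique)
open import Data.Nat as ℕ using (ℕ; zero; suc; _≤_)
open import Data.Nat.Coprimality as Coprimality using (Coprime; coprime-divisor)
open import Data.Nat.Divisibility as ℕ∣ using (_∣_; divides)
import Data.Nat.Properties as ℕP
import Data.Nat.Tactic.RingSolver as ℕSolver
open import Data.Product using (Σ; ∃; _×_; _,_; proj₁; proj₂)
open import Data.Rational as ℚ using (ℚ; mkℚ; ↥_; ↧_; ↧ₙ_; toℚᵘ)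
open import Data.Rational.Properties using (toℚᵘ-homo-+; toℚᵘ-homo-*; toℚᵘ-fromℚᵘ)
import Data.Rational.Unnormalised as ℚᵘ
import Data.Rational.Unnormalised.Properties as ℚᵘP
open import Data.Sum using (inj₁; inj₂)
open import Function using (_∘_)
open import Relation.Binary.Definitions using (tri<; tri≈; tri>)
open import Relation.Binary.PropositionalEquality
open import Relation.Nullary using (¬_; yes; no)
open import Relation.Nullary.Decidable using (¬¬-excluded-middle)

open import Defs
open import Algebra.Properties.AbelianGroup ℤP.+-0-abelianGroup using (∙-cancelˡ)

unreduced : ℤ → ℤ → ℕ → ℤ
unreduced c n d = n ℤ.* n ℤ.+ c ℤ.* + (d ℕ.* d)

sq+-unnormalised : ∀ c q →
  toℚᵘ (sq+ c q) ℚᵘ.≃ toℚᵘ q ℚᵘ.* toℚᵘ q ℚᵘ.+ ℚᵘ.mkℚᵘ c 0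
sq+-unnormalised c q =
  ℚᵘP.≃-trans (toℚᵘ-homo-+ (q ℚ.* q) (c ℚ./ 1))
    (ℚᵘP.+-cong (toℚᵘ-homo-* q q) (toℚᵘ-fromℚᵘ (ℚᵘ.mkℚᵘ c 0)))

sq+-cross : ∀ c q →
  ↥ (sq+ c q) ℤ.* + (↧ₙ q ℕ.* ↧ₙ q) ≡ unreduced c (↥ q) (↧ₙ q) ℤ.* ↧ (sq+ c q)
sq+-cross c q@(mkℚ n d-1 _) with sq+ c q | sq+-unnormalised c q
... | mkℚ m e-1 _ | ℚᵘ.*≡* cross = begin
    m ℤ.* + D                                         ≡⟨ cong (λ k → m ℤ.* + k) (ℕP.*-identityʳ D) ⟨
    m ℤ.* + (D ℕ.* 1)                                 ≡⟨ cross ⟩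
    (n ℤ.* n ℤ.* ℤ.1ℤ ℤ.+ c ℤ.* + D) ℤ.* + suc e-1    ≡⟨ cong (λ k → (k ℤ.+ c ℤ.* + D) ℤ.* + suc e-1)
                                                             (ℤP.*-identityʳ (n ℤ.* n)) ⟩
    (n ℤ.* n ℤ.+ c ℤ.* + D) ℤ.* + suc e-1             ∎
  where
  open ≡-Reasoning
  D : ℕ
  D = suc d-1 ℕ.* suc d-1

coprime-*ˡ : ∀ {m n x} → Coprime m x → Coprime n x → Coprime (m ℕ.* n) x
coprime-*ˡ {m} {n} {x} m⊥x n⊥x {j} (j∣mn , j∣x) = n⊥x (j∣n , j∣x)
  where
  j⊥m : Coprime j m
  j⊥m (i∣j , i∣m) = m⊥x (i∣m , ℕ∣.∣-trans i∣j j∣x)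
  j∣n : j ∣ n
  j∣n = coprime-divisor j⊥m j∣mn

-- A common divisor i of d and n² + c·d² divides n²; being coprime to n (as a divisor
-- of d) it divides n, so i = 1: the unreduced numerator stays coprime to d.
unreduced-coprime : ∀ c n d → Coprime ∣ n ∣ d → Coprime d ∣ unreduced c n d ∣
unreduced-coprime c n d n⊥d {i} (i∣d , i∣X) = n⊥d (i∣n , i∣d)
  where
  i∣dd : i ∣ d ℕ.* d
  i∣dd = ℕ∣.∣-trans i∣d (ℕ∣.m∣m*n d)
  i∣n² : i ∣ ∣ n ∣ ℕ.* ∣ n ∣
  i∣n² = subst (i ∣_) (ℤP.abs-* n n) (ℤ∣.∣⇒∣ᵤ i∣nn)
    where
    i∣nn : + i ℤ∣.∣ n ℤ.* n
    i∣nn = ℤ∣.∣m+n∣n⇒∣m (ℤ∣.∣ᵤ⇒∣ i∣X) (ℤ∣.∣n⇒∣m*n c (ℤ∣.∣ᵤ⇒∣ i∣dd))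
  i⊥n : Coprime i ∣ n ∣
  i⊥n (j∣i , j∣n) = n⊥d (j∣n , ℕ∣.∣-trans j∣i i∣d)
  i∣n : i ∣ ∣ n ∣
  i∣n = coprime-divisor i⊥n i∣n²

denominator-squares : ∀ c q → ↧ₙ q ℕ.* ↧ₙ q ∣ ↧ₙ (sq+ c q)
denominator-squares c q@(mkℚ n d-1 n⊥d) =
  coprime-divisor (coprime-*ˡ d⊥X d⊥X) (divides ∣ ↥ r ∣ (sym cleared))
  where
  r : ℚ
  r = sq+ c q
  X : ℤ
  X = unreduced c n (suc d-1)
  d⊥X : Coprime (suc d-1) ∣ X ∣
  d⊥X = unreduced-coprime c n (suc d-1) (Coprimality.recompute n⊥d)
  cleared : ∣ ↥ r ∣ ℕ.* (suc d-1 ℕ.* suc d-1) ≡ ∣ X ∣ ℕ.* ↧ₙ r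
  cleared = trans (sym (ℤP.abs-* (↥ r) _)) (trans (cong ∣_∣ (sq+-cross c q)) (ℤP.abs-* X (↧ r)))

reduced-integral : ∀ r → ↧ₙ r ∣ ∣ ↥ r ∣ → ↧ₙ r ≡ 1
reduced-integral (mkℚ m e-1 m⊥e) e∣m = Coprimality.recompute m⊥e (e∣m , ℕ∣.∣-refl)

sq+-integer : ∀ c q → ↧ₙ q ≡ 1 → ↥ (sq+ c q) ≡ ↥ q ℤ.* ↥ q ℤ.+ c
sq+-integer c q@(mkℚ n zero _) refl = begin
    ↥ r                        ≡⟨ cleared ⟩
    X ℤ.* + ↧ₙ r               ≡⟨ cong (λ e → X ℤ.* + e) (reduced-integral r e∣m) ⟩
    X ℤ.* ℤ.1ℤ                 ≡⟨ ℤP.*-identityʳ X ⟩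
    n ℤ.* n ℤ.+ c ℤ.* ℤ.1ℤ     ≡⟨ cong (λ k → n ℤ.* n ℤ.+ k) (ℤP.*-identityʳ c) ⟩
    n ℤ.* n ℤ.+ c              ∎
  where
  open ≡-Reasoning
  r : ℚ
  r = sq+ c q
  X : ℤ
  X = unreduced c n 1
  cleared : ↥ r ≡ X ℤ.* ↧ r
  cleared = trans (sym (ℤP.*-identityʳ (↥ r))) (sq+-cross c q)
  e∣m : ↧ₙ r ∣ ∣ ↥ r ∣
  e∣m = divides ∣ X ∣ (trans (cong ∣_∣ cleared) (ℤP.abs-* X (↧ r)))

square-≤-self : ∀ d .{{_ : ℕ.NonZero d}} → d ℕ.* d ≤ d → d ≡ 1
square-≤-self d dd≤d =
  ℕP.≤-antisym (ℕP.*-cancelˡ-≤ d (subst (d ℕ.* d ≤_) (sym (ℕP.*-identityʳ d)) dd≤d))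
               (ℕ.>-nonZero⁻¹ d)

module _ {X : Set} (P : X → Set) (f : X → ℕ) where

  MaximalAmong : List X → X → Set
  MaximalAmong L a = P a × (∀ x → P x → x ∈ L → f x ≤ f a)

  maximal-∷ : ∀ {L a y} → MaximalAmong L a → P y → ∃ (MaximalAmong (y ∷ L))
  maximal-∷ {a = a} {y} (Pa , max) Py with ℕP.≤-total (f y) (f a)
  ... | inj₁ fy≤fa = a , Pa , λ where
    x Px (here refl)  → fy≤fa
    x Px (there x∈L)  → max x Px x∈L
  ... | inj₂ fa≤fy = y , Py , λ where
    x Px (here refl)  → ℕP.≤-refl
    x Px (there x∈L)  → ℕP.≤-trans (max x Px x∈L) fa≤fy

  -- Membership in P need not be decidable, so the maximum over a list exists only
  -- under double negation (excluded middle for each listed element).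
  ¬¬-maximal-among : ∀ {x₀} → P x₀ → ∀ L → ¬ ¬ ∃ (MaximalAmong L)
  ¬¬-maximal-among Px₀ [] k = k (_ , Px₀ , λ _ _ ())
  ¬¬-maximal-among Px₀ (y ∷ L) k = ¬¬-maximal-among Px₀ L λ (a , Pa , max) →
    ¬¬-excluded-middle λ where
      (yes Py) → k (maximal-∷ (Pa , max) Py)
      (no ¬Py) → k (a , Pa , λ where
        x Px (here refl)  → ⊥-elim (¬Py Px)
        x Px (there x∈L)  → max x Px x∈L)

  ¬¬-maximum : ∀ {x₀} → P x₀ → (L : List X) → (∀ x → P x → x ∈ L) →
    ¬ ¬ Σ X (λ a → P a × (∀ x → P x → f x ≤ f a))
  ¬¬-maximum Px₀ L covered k = ¬¬-maximal-among Px₀ L λ (a , Pa , max) →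
    k (a , Pa , λ x Px → max x Px (covered x Px))

two-steps : ∀ {a b c} → a ℤ.< b → b ℤ.< c → ℤ.suc (ℤ.suc a) ℤ.≤ c
two-steps a<b b<c = ℤP.≤-trans (ℤP.suc-mono (ℤP.i<j⇒suc[i]≤j a<b)) (ℤP.i<j⇒suc[i]≤j b<c)

spread : (Pr : ℤ → Set) {x y z : ℤ} → Pr x → Pr y → Pr z → x ≢ y → x ≢ z → y ≢ z →
  Σ ℤ λ lo → Σ ℤ λ hi → Pr lo × Pr hi × ℤ.suc (ℤ.suc lo) ℤ.≤ hi
spread Pr {x} {y} {z} px py pz x≢y x≢z y≢z
  with ℤP.<-cmp x y | ℤP.<-cmp y z | ℤP.<-cmp x z
... | tri≈ _ x≡y _ | _ | _ = ⊥-elim (x≢y x≡y)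
... | _ | tri≈ _ y≡z _ | _ = ⊥-elim (y≢z y≡z)
... | _ | _ | tri≈ _ x≡z _ = ⊥-elim (x≢z x≡z)
... | tri< x<y _ _ | tri< y<z _ _ | _            = x , z , px , pz , two-steps x<y y<z
... | tri< _ _ _   | tri> _ _ z<y | tri< x<z _ _ = x , y , px , py , two-steps x<z z<y
... | tri< x<y _ _ | tri> _ _ _   | tri> _ _ z<x = z , y , pz , py , two-steps z<x x<y
... | tri> _ _ y<x | tri< _ _ _   | tri< x<z _ _ = y , z , py , pz , two-steps y<x x<z
... | tri> _ _ _   | tri< y<z _ _ | tri> _ _ z<x = y , x , py , px , two-steps y<z z<x
... | tri> _ _ y<x | tri> _ _ z<y | _            = z , x , pz , px , two-steps z<y y<x

no-three-with-abs : ∀ {n} x y z → ∣ x ∣ ≡ n → ∣ y ∣ ≡ n → ∣ z ∣ ≡ n →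
  x ≢ y → x ≢ z → y ≢ z → ⊥
no-three-with-abs (+ a) (+ b) _ refl eb _ x≢y _ _ = x≢y (cong +_ (sym eb))
no-three-with-abs (+ a) -[1+ b ] (+ c) refl _ ec _ x≢z _ = x≢z (cong +_ (sym ec))
no-three-with-abs (+ a) -[1+ b ] -[1+ c ] refl eb ec _ _ y≢z =
  y≢z (cong -[1+_] (ℕP.suc-injective (trans eb (sym ec))))
no-three-with-abs -[1+ a ] -[1+ b ] _ refl eb _ x≢y _ _ =
  x≢y (cong -[1+_] (ℕP.suc-injective (sym eb)))
no-three-with-abs -[1+ a ] (+ b) -[1+ c ] refl _ ec _ x≢z _ =
  x≢z (cong -[1+_] (ℕP.suc-injective (sym ec)))
no-three-with-abs -[1+ a ] (+ b) (+ c) refl eb ec _ _ y≢z = y≢z (cong +_ (trans eb (sym ec)))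

abs-bounds : ∀ z A → ∣ z ∣ ≤ A → (ℤ.- + A ℤ.≤ z) × (z ℤ.≤ + A)
abs-bounds (+ n)    A    n≤A         = ℤP.neg-≤-pos , ℤ.+≤+ n≤A
abs-bounds -[1+ n ] (suc A) (ℕ.s≤s n≤A) = ℤ.-≤- n≤A , ℤ.-≤+

square-abs : ∀ z → z ℤ.* z ≡ + (∣ z ∣ ℕ.* ∣ z ∣)
square-abs (+ n)    = ℤP.+◃n≡+n (n ℕ.* n)
square-abs -[1+ n ] = ℤP.+◃n≡+n (suc n ℕ.* suc n)

below-square : ∀ {α A} → α ℕ.< A → A ℕ.+ α ℕ.* α ℕ.+ A ℕ.< A ℕ.* A ℕ.+ 2
below-square {α} (ℕ.s≤s α≤A′) with ℕP.m≤n⇒∃[o]m+o≡n (ℕ.s≤s α≤A′)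
... | t , refl = subst (B ℕ.+ α ℕ.* α ℕ.+ B ℕ.<_) (sym (expand α t))
                       (ℕ.s≤s (ℕP.m≤m+n _ (2 ℕ.* α ℕ.* t ℕ.+ t ℕ.* t)))
  where
  B = suc α ℕ.+ t
  expand : ∀ α t → (suc α ℕ.+ t) ℕ.* (suc α ℕ.+ t) ℕ.+ 2
    ≡ suc ((suc α ℕ.+ t) ℕ.+ α ℕ.* α ℕ.+ (suc α ℕ.+ t) ℕ.+ (2 ℕ.* α ℕ.* t ℕ.+ t ℕ.* t))
  expand = ℕSolver.solve-∀

square-squeeze : ∀ {α A} → α ≤ A → A ℕ.* A ℕ.+ 2 ≤ A ℕ.+ α ℕ.* α ℕ.+ A → α ≡ A
square-squeeze α≤A big with ℕP.m≤n⇒m<n∨m≡n α≤A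
... | inj₁ α<A = ⊥-elim (ℕP.<⇒≱ (below-square α<A) big)
... | inj₂ α≡A = α≡A

-- Adding  lo + 2 ≤ hi,  A² + hi ≤ A  and  -A ≤ α² + lo  gives  A² + 2 ≤ 2A + α².
gap-inequality : ∀ (A α : ℕ) (lo hi : ℤ) → ℤ.suc (ℤ.suc lo) ℤ.≤ hi →
  + (A ℕ.* A) ℤ.+ hi ℤ.≤ + A → ℤ.- + A ℤ.≤ + (α ℕ.* α) ℤ.+ lo →
  A ℕ.* A ℕ.+ 2 ≤ A ℕ.+ α ℕ.* α ℕ.+ A
gap-inequality A α lo hi lo+2≤hi top bottom = ℤP.drop‿+≤+
  (subst₂ ℤ._≤_ (left lo hi (+ (A ℕ.* A)) (+ A)) (right lo hi (+ (α ℕ.* α)) (+ A))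
    (ℤP.+-monoˡ-≤ (ℤ.- (lo ℤ.+ hi ℤ.- + A)) (ℤP.+-mono-≤ (ℤP.+-mono-≤ lo+2≤hi top) bottom)))
  where
  left : ∀ lo hi A² A → ℤ.1ℤ ℤ.+ (ℤ.1ℤ ℤ.+ lo) ℤ.+ (A² ℤ.+ hi) ℤ.+ ℤ.- A ℤ.+ ℤ.- (lo ℤ.+ hi ℤ.- A)
    ≡ A² ℤ.+ (ℤ.1ℤ ℤ.+ ℤ.1ℤ)
  left = ℤSolver.solve-∀
  right : ∀ lo hi α² A → hi ℤ.+ A ℤ.+ (α² ℤ.+ lo) ℤ.+ ℤ.- (lo ℤ.+ hi ℤ.- A) ≡ A ℤ.+ α² ℤ.+ A
  right = ℤSolver.solve-∀

Closed : (ℤ → Set) → ℤ → Set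
Closed O c = ∀ {z} → O z → O (z ℤ.* z ℤ.+ c)

no-maximal-element : (O : ℤ → Set) {c₁ c₂ c₃ : ℤ} → c₁ ≢ c₂ → c₁ ≢ c₃ → c₂ ≢ c₃ →
  Closed O c₁ → Closed O c₂ → Closed O c₃ →
  ∀ {a} → O a → ¬ (∀ {u} → O u → ∣ u ∣ ≤ ∣ a ∣)
no-maximal-element O {c₁} {c₂} {c₃} c₁≢c₂ c₁≢c₃ c₂≢c₃ cl₁ cl₂ cl₃ {a} Oa bounded
  with spread (Closed O) cl₁ cl₂ cl₃ c₁≢c₂ c₁≢c₃ c₂≢c₃
... | lo , hi , cl-lo , cl-hi , lo+2≤hi =
  no-three-with-abs (a ℤ.* a ℤ.+ c₁) (a ℤ.* a ℤ.+ c₂) (a ℤ.* a ℤ.+ c₃)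
    (extremal (cl₁ Oa)) (extremal (cl₂ Oa)) (extremal (cl₃ Oa))
    (shift-injective c₁≢c₂) (shift-injective c₁≢c₃) (shift-injective c₂≢c₃)
  where
  A : ℕ
  A = ∣ a ∣
  -- a² + hi lies in O, so A² + hi ≤ A.
  top : + (A ℕ.* A) ℤ.+ hi ℤ.≤ + A
  top = subst (λ s → s ℤ.+ hi ℤ.≤ + A) (square-abs a)
          (proj₂ (abs-bounds _ A (bounded (cl-hi Oa))))
  -- u² + lo lies in O, so u² + lo ≥ -A.
  bottom : ∀ {u} → O u → ℤ.- + A ℤ.≤ + (∣ u ∣ ℕ.* ∣ u ∣) ℤ.+ lo
  bottom {u} Ou = subst (λ s → ℤ.- + A ℤ.≤ s ℤ.+ lo) (square-abs u)
                    (proj₁ (abs-bounds _ A (bounded (cl-lo Ou))))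
  extremal : ∀ {u} → O u → ∣ u ∣ ≡ A
  extremal {u} Ou = square-squeeze (bounded Ou) (gap-inequality A ∣ u ∣ lo hi lo+2≤hi top (bottom Ou))
  shift-injective : ∀ {c c′} → c ≢ c′ → a ℤ.* a ℤ.+ c ≢ a ℤ.* a ℤ.+ c′
  shift-injective c≢c′ eq = c≢c′ (∙-cancelˡ (a ℤ.* a) _ _ eq)

-- Orbit elements of maximal denominator force every orbit element to be an integer:
-- den(a)² ≤ den(a² + c) ≤ den(a) gives den(a) = 1.
orbit-integral : ∀ {cs P c a} → c ∈ cs → Orbit cs P a →
  (∀ q → Orbit cs P q → ↧ₙ q ≤ ↧ₙ a) → ∀ q → Orbit cs P q → ↧ₙ q ≡ 1
orbit-integral {c = c} {a} c∈cs Oa max q Oq =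
  ℕP.≤-antisym (ℕP.≤-trans (max q Oq) (ℕP.≤-reflexive den-a≡1)) (ℕ.s≤s ℕ.z≤n)
  where
  den-a≡1 : ↧ₙ a ≡ 1
  den-a≡1 = square-≤-self (↧ₙ a)
    (ℕP.≤-trans (ℕ∣.∣⇒≤ (denominator-squares c a)) (max _ (next c∈cs Oa)))

Numerators : List ℤ → ℚ → ℤ → Set
Numerators cs P z = ∃ λ q → Orbit cs P q × ↥ q ≡ z

numerators-closed : ∀ {cs P c} → (∀ q → Orbit cs P q → ↧ₙ q ≡ 1) → c ∈ cs →
  Closed (Numerators cs P) c
numerators-closed {c = c} integral c∈cs (q , Oq , refl) =
  sq+ c q , next c∈cs Oq , sq+-integer c q (integral q Oq)

corollary1p2 : (cs : List ℤ) → Unique cs → 3 ≤ length cs →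
    (P : ℚ) → ¬ FiniteOrbit cs P
corollary1p2 [] _ ()
corollary1p2 (_ ∷ []) _ (ℕ.s≤s ())
corollary1p2 (_ ∷ _ ∷ []) _ (ℕ.s≤s (ℕ.s≤s ()))
corollary1p2 cs@(c₁ ∷ c₂ ∷ c₃ ∷ _) ((c₁≢c₂ ∷ c₁≢c₃ ∷ _) ∷ (c₂≢c₃ ∷ _) ∷ _) _ P (L , covered) =
  ¬¬-maximum (Orbit cs P) ↧ₙ_ (first c₁∈cs) L covered λ (a , Oa , den-max) →
  let integral : ∀ q → Orbit cs P q → ↧ₙ q ≡ 1
      integral = orbit-integral c₁∈cs Oa den-max
      closed : ∀ {c} → c ∈ cs → Closed (Numerators cs P) c
      closed = numerators-closed integral
  in ¬¬-maximum (Orbit cs P) (∣_∣ ∘ ↥_) (first c₁∈cs) L covered λ (b , Ob , num-max) →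
  no-maximal-element (Numerators cs P) c₁≢c₂ c₁≢c₃ c₂≢c₃
    (closed c₁∈cs) (closed c₂∈cs) (closed c₃∈cs) (b , Ob , refl)
    λ { (q , Oq , refl) → num-max q Oq }
  where
  c₁∈cs : c₁ ∈ cs
  c₁∈cs = here refl
  c₂∈cs : c₂ ∈ cs
  c₂∈cs = there (here refl)
  c₃∈cs : c₃ ∈ cs
  c₃∈cs = there (there (here refl))
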